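{- Let $k>1$ and let $r_1>r_2>\ldots>r_k$ be pairwise coprime integers greater than 1 such that $r_i$ is coprime to $i$ for $1\leq i\leq k$. Suppose that for each $i,j$ with $1\leq i<j\leq k$ there exists a positive integer $m_{i,j}$ such that $r_i-r_j=m_{i,j}(j-i)$ and $r_j\geq m_{i,j}(i-1)j$. Let $\mathbb{T}=\mathbb{Z}_{r_1}\times\mathbb{Z}_{r_2}\times\ldots\times\mathbb{Z}_{r_k}$. Let $\mathbf{o}=(1,1,\ldots,1)$, $\mathbf{u}=(1,2,\ldots,k)$ and, for each $i$, let $\mathbf{e}_i\in\mathbb{T}$ be the element whose $i$th coordinate is $1$ and all other coordinates are $0$; let $A$ be the set consisting of these $k+2$ elements. Let $c_{\mathbf{o}}=\max_{1\leq i<j\leq k}(r_j+j\,m_{i,j})$, $c_{\mathbf{u}}=r_1$, and $c_{\mathbf{e}_i}=r_i$ for each $i$. Then, for every element $\mathbf{x}$ of $\mathbb{T}$ and every $k$-element subset $S$ of $A$, there exist nonnegative integers $h_{\mathbf{s}}<c_{\mathbf{s}}$ for each $\mathbf{s}\in S$ such that $\mathbf{x}=\sum_{\mathbf{s}\in S}h_{\mathbf{s}}\mathbf{s}$.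
   Context: $\mathbb{Z}_n$ denotes the cyclic group of integers modulo $n$, written additively. -}

module Defs where

open import Data.Nat using (ℕ; zero; suc; _+_; _*_; _⊔_)
open import Data.Fin using (Fin; zero; suc; toℕ; _<?_)
open import Data.Fin.Properties using (_≟_)
open import Data.List using (List; foldr; map; allFin)
open import Relation.Nullary using (does)
open import Data.Bool using (if_then_else_)

ΣFin : (n : ℕ) → (Fin n → ℕ) → ℕ
ΣFin n f = foldr _+_ 0 (map f (allFin n))

⨆Fin : (n : ℕ) → (Fin n → ℕ) → ℕ
⨆Fin n f = foldr _⊔_ 0 (map f (allFin n))

-- The set A ⊆ T, indexed by Fin (k + 2):
--   index 0 ↦ o = (1,…,1),  index 1 ↦ u = (1,2,…,k),  index 2+i ↦ e_i.
-- (Coordinates are given by natural-number representatives; coordinate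
-- i : Fin k is the paper's coordinate toℕ i + 1.)
elemA : (k : ℕ) → Fin (suc (suc k)) → Fin k → ℕ
elemA k zero i = 1
elemA k (suc zero) i = suc (toℕ i)
elemA k (suc (suc t)) i = if does (t ≟ i) then 1 else 0

-- c_o = max_{1 ≤ i < j ≤ k} (r_j + j m_{i,j})   (paper's 1-indexed j = toℕ j + 1)
cO : (k : ℕ) → (r : Fin k → ℕ) → (m : Fin k → Fin k → ℕ) → ℕ
cO k r m = ⨆Fin k (λ i → ⨆Fin k (λ j →
  if does (i <? j) then r j + suc (toℕ j) * m i j else 0))

-- The bounds c_s for s ∈ A:  c_o, c_u = r_1 (passed as r₁), c_{e_i} = r_i.
cA : (k : ℕ) → (r : Fin k → ℕ) → (m : Fin k → Fin k → ℕ) → (r₁ : ℕ) → Fin (suc (suc k)) → ℕ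
cA k r m r₁ zero = cO k r m
cA k r m r₁ (suc zero) = r₁
cA k r m r₁ (suc (suc t)) = r t

-- Only the coefficients h_o and h_u need to be chosen: once h_o + i h_u ≡ x_i (mod r_i) holds at
-- every coordinate i with e_i ∉ S, the coefficients of the e_i ∈ S are residues modulo r_i.  As
-- |S| = k, at most two coordinates are left uncovered.  With one uncovered coordinate i, take
-- h_o = x_i, or solve i h_u ≡ x_i (mod r_i), which is possible because gcd(r_i, i) = 1.  With two,
-- i < j, put m = m_{i,j} and W = r_j + j m, which is coprime to m.  By the Chinese remainder theorem
-- there is n ∈ [m W, m W + r_i r_j) with n ≡ m x_i (mod r_i) and n ≡ m x_j (mod r_j); write
-- n = m a + W b with a < W.  Since r_i = r_j + m (j - i), this single identity reads both as
-- n = m (a + i b) + r_i b and as n = m (a + j b) + r_j b, and cancelling m (coprime to r_i and r_j)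
-- shows that h_o = a < c_o and h_u = b solve both congruences.  Finally b < r_i ≤ r_1 because
-- b W ≤ n < m W + r_i r_j ≤ r_i W.

module Submission where

module Congruence where
  open import Data.Nat.Base as ℕ using (ℕ; NonZero)
  open import Data.Nat.Coprimality using (Coprime; coprime-Bézout)
  open import Data.Nat.GCD using (module Bézout)
  import Data.Nat.Divisibility as ℕ
  open import Data.Integer.Base using (ℤ; +_; -_; _+_; _-_; _*_; 0ℤ; 1ℤ)
  open import Data.Integer.Properties using (pos-+; pos-*)
  open import Data.Integer.DivMod using (_%ℕ_; _/ℕ_; n%ℕd<d; a≡a%ℕn+[a/ℕn]*n)
  open import Data.Integer.Divisibility.Signed
  import Data.Integer.Divisibility as Unsigned
  import Data.Integer.Coprimality as ℤ
  open import Data.Integer.Tactic.RingSolver using (solve-∀)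
  open import Data.Product using (∃; _×_; _,_)
  open import Relation.Binary.PropositionalEquality

  infix 4 _≡_mod_

  -- Opaque, so that a, b and n can be inferred from the type of a congruence.
  opaque
    _≡_mod_ : ℤ → ℤ → ℕ → Set
    _≡_mod_ a b n = + n ∣ a - b

  opaque
    unfolding _≡_mod_

    mod-reflexive : ∀ {a b n} → a ≡ b → a ≡ b mod n
    mod-reflexive {a} {n = n} refl = divides 0ℤ (a-a≡0*n a (+ n))
      where
      a-a≡0*n : ∀ a n → a - a ≡ 0ℤ * n
      a-a≡0*n = solve-∀

    mod-sym : ∀ {a b n} → a ≡ b mod n → b ≡ a mod n
    mod-sym {a} {b} {n} n∣a-b = subst (+ n ∣_) (-[a-b]≡b-a a b) (∣m⇒∣-m n∣a-b)
      where
      -[a-b]≡b-a : ∀ a b → - (a - b) ≡ b - a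
      -[a-b]≡b-a = solve-∀

    mod-trans : ∀ {a b c n} → a ≡ b mod n → b ≡ c mod n → a ≡ c mod n
    mod-trans {a} {b} {c} {n} n∣a-b n∣b-c = subst (+ n ∣_) (telescope a b c) (∣m∣n⇒∣m+n n∣a-b n∣b-c)
      where
      telescope : ∀ a b c → (a - b) + (b - c) ≡ a - c
      telescope = solve-∀

    *-congˡ-mod : ∀ {a b n} c → a ≡ b mod n → c * a ≡ c * b mod n
    *-congˡ-mod {a} {b} {n} c n∣a-b = subst (+ n ∣_) (distrib c a b) (∣n⇒∣m*n c n∣a-b)
      where
      distrib : ∀ c a b → c * (a - b) ≡ c * a - c * b
      distrib = solve-∀

    *-cancelˡ-mod : ∀ {n a b m} → Coprime n m → + m * a ≡ + m * b mod n → a ≡ b mod n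
    *-cancelˡ-mod {n} {a} {b} {m} n⊥m n∣ma-mb = ∣ᵤ⇒∣ (ℤ.coprime-divisor (+ n) (+ m) (a - b) n⊥m
      (∣⇒∣ᵤ (subst (+ n ∣_) (sym (distrib (+ m) a b)) n∣ma-mb)))
      where
      distrib : ∀ c a b → c * (a - b) ≡ c * a - c * b
      distrib = solve-∀

    mod⇒∣ : ∀ {a b n} → a ≡ b mod n → + n Unsigned.∣ a - b
    mod⇒∣ = ∣⇒∣ᵤ

    mod-∣ : ∀ {a b n d} → d ℕ.∣ n → a ≡ b mod n → a ≡ b mod d
    mod-∣ d∣n n∣a-b = ∣-trans (∣ᵤ⇒∣ d∣n) n∣a-b

    +-multiple-mod : ∀ {n} a k → + (a ℕ.+ n ℕ.* k) ≡ + a mod n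
    +-multiple-mod {n} a k = divides (+ k) (begin
      + (a ℕ.+ n ℕ.* k) - + a   ≡⟨ cong (_- + a) (trans (pos-+ a (n ℕ.* k)) (cong (λ v → + a + v) (pos-* n k))) ⟩
      + a + + n * + k - + a     ≡⟨ cancel (+ a) (+ n) (+ k) ⟩
      + k * + n                 ∎)
      where
      open ≡-Reasoning
      cancel : ∀ a n k → a + n * k - a ≡ k * n
      cancel = solve-∀

    +-mod⇒∣ : ∀ {n} a f → + (a ℕ.+ f) ≡ + a mod n → n ℕ.∣ f
    +-mod⇒∣ {n} a f n∣a+f-a = ∣⇒∣ᵤ (subst (+ n ∣_) (trans (cong (_- + a) (pos-+ a f)) (cancel (+ a) (+ f))) n∣a+f-a)
      where
      cancel : ∀ a f → a + f - a ≡ f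
      cancel = solve-∀

    residue : ∀ z n .{{_ : NonZero n}} → ∃ λ h → h ℕ.< n × + h ≡ z mod n
    residue z n = z %ℕ n , n%ℕd<d z n , divides (- (z /ℕ n)) (begin
      + (z %ℕ n) - z                             ≡⟨ cong (λ v → + (z %ℕ n) - v) (a≡a%ℕn+[a/ℕn]*n z n) ⟩
      + (z %ℕ n) - (+ (z %ℕ n) + z /ℕ n * + n)   ≡⟨ cancel (+ (z %ℕ n)) (z /ℕ n) (+ n) ⟩
      - (z /ℕ n) * + n                           ∎)
      where
      open ≡-Reasoning
      cancel : ∀ r q n → r - (r + q * n) ≡ - q * n
      cancel = solve-∀

    residue-above : ∀ base z n .{{_ : NonZero n}} → ∃ λ h → h ℕ.< n × + (base ℕ.+ h) ≡ z mod n
    residue-above base z n with residue (z - + base) n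
    ... | h , h<n , h≡z-base = h , h<n , subst (+ n ∣_) shift h≡z-base
      where
      shift : + h - (z - + base) ≡ + (base ℕ.+ h) - z
      shift = trans (rearrange (+ base) (+ h) z) (cong (_- z) (sym (pos-+ base h)))
        where
        rearrange : ∀ b h z → h - (z - b) ≡ b + h - z
        rearrange = solve-∀

    mod-inverse : ∀ {n c} → Coprime c n → ∃ λ u → + c * u ≡ 1ℤ mod n
    mod-inverse {n} {c} c⊥n with coprime-Bézout c⊥n
    ... | Bézout.+- x y 1+yn≡xc = + x , divides (+ y) (begin
      + c * + x - 1ℤ            ≡⟨ swap (+ c) (+ x) ⟩
      + x * + c - 1ℤ            ≡⟨ cong (_- 1ℤ) (sym (pos-* x c)) ⟩
      + (x ℕ.* c) - 1ℤ          ≡⟨ cong (λ v → + v - 1ℤ) (sym 1+yn≡xc) ⟩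
      1ℤ + + (y ℕ.* n) - 1ℤ     ≡⟨ cancel (+ (y ℕ.* n)) ⟩
      + (y ℕ.* n)               ≡⟨ pos-* y n ⟩
      + y * + n                 ∎)
      where
      open ≡-Reasoning
      swap : ∀ c x → c * x - 1ℤ ≡ x * c - 1ℤ
      swap = solve-∀
      cancel : ∀ a → 1ℤ + a - 1ℤ ≡ a
      cancel = solve-∀
    ... | Bézout.-+ x y 1+xc≡yn = - + x , divides (- + y) (begin
      + c * - + x - 1ℤ          ≡⟨ negate (+ c) (+ x) ⟩
      - (1ℤ + + x * + c)        ≡⟨ cong (λ v → - (1ℤ + v)) (sym (pos-* x c)) ⟩
      - + (1 ℕ.+ x ℕ.* c)       ≡⟨ cong (λ v → - + v) 1+xc≡yn ⟩
      - + (y ℕ.* n)             ≡⟨ cong -_ (pos-* y n) ⟩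
      - (+ y * + n)             ≡⟨ neg-* (+ y) (+ n) ⟩
      - + y * + n               ∎)
      where
      open ≡-Reasoning
      negate : ∀ c x → c * - x - 1ℤ ≡ - (1ℤ + x * c)
      negate = solve-∀
      neg-* : ∀ y n → - (y * n) ≡ - y * n
      neg-* = solve-∀

    linear-congruence : ∀ {c n} → Coprime c n → ∀ z → ∃ λ u → + c * u ≡ z mod n
    linear-congruence {c} {n} c⊥n z with mod-inverse c⊥n
    ... | u , cu≡1 = u * z , subst (+ n ∣_) (distrib (+ c) u z) (∣m⇒∣m*n z cu≡1)
      where
      distrib : ∀ c u z → (c * u - 1ℤ) * z ≡ c * (u * z) - z
      distrib = solve-∀

    chinese-remainder : ∀ {P Q} → Coprime P Q → ∀ A B → ∃ λ z → z ≡ A mod P × z ≡ B mod Q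
    chinese-remainder {P} {Q} P⊥Q A B with linear-congruence P⊥Q (B - A)
    ... | v , Pv≡B-A = A + + P * v , divides v (cancel A (+ P) v) , subst (+ Q ∣_) (shift A B (+ P * v)) Pv≡B-A
      where
      cancel : ∀ A P v → A + P * v - A ≡ v * P
      cancel = solve-∀
      shift : ∀ A B w → w - (B - A) ≡ A + w - B
      shift = solve-∀

  bounded-linear-congruence : ∀ {c} n .{{_ : NonZero n}} → Coprime c n → ∀ z →
                              ∃ λ h → h ℕ.< n × + (c ℕ.* h) ≡ z mod n
  bounded-linear-congruence {c} n c⊥n z with linear-congruence c⊥n z
  ... | u , cu≡z with residue u n
  ...   | h , h<n , h≡u = h , h<n ,
          subst (_≡ z mod n) (sym (pos-* c h)) (mod-trans (*-congˡ-mod (+ c) h≡u) cu≡z)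

  coefficient-congruence : ∀ {M m c b n x} → Coprime M m → m ℕ.* c ℕ.+ M ℕ.* b ≡ n →
                           + n ≡ + m * x mod M → + c ≡ x mod M
  coefficient-congruence {M} {m} {c} {b} M⊥m mc+Mb≡n n≡mx = *-cancelˡ-mod M⊥m (mod-trans mc≡n n≡mx)
    where
    mc≡n : + m * + c ≡ + _ mod M
    mc≡n = subst₂ (λ u v → u ≡ + v mod M) (pos-* m c) mc+Mb≡n (mod-sym (+-multiple-mod (m ℕ.* c) b))

open import Defs
open import Data.Nat using (ℕ; zero; suc; _+_; _*_; _<_; _≤_; _≥_; _∸_; _⊔_; s≤s; z≤n; z<s; NonZero; >-nonZero)
open import Data.Nat.Properties
  using (<-trans; ≤-refl; ≤-trans; ≤-reflexive; <⇒≤; <-≤-trans; +-comm; +-suc; +-identityʳ; *-identityʳ;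
         *-zeroʳ; m≤m+n; m≤n+m; m<m+n; m≤m⊔n; m≤n⊔m; +-monoʳ-<; *-monoʳ-≤; *-cancelʳ-<; m*n≢0; m+n∸m≡n;
         m+n∸n≡m; m≤n⇒∃[o]m+o≡n; suc-injective; module ≤-Reasoning)
import Data.Nat.Divisibility as ℕ
open import Data.Nat.Divisibility using (divides; ∣m+n∣m⇒∣n; ∣m∣n⇒∣m+n; ∣m⇒∣m*n; ∣n⇒∣m*n; m∣m*n; n∣m*n)
open import Data.Nat.Coprimality using (Coprime)
import Data.Nat.Coprimality as Coprime
open import Data.Nat.Tactic.RingSolver using (solve-∀)
open import Data.Fin using (Fin; zero; suc; toℕ; fromℕ<; _<?_)
open import Data.Fin.Properties using (_≟_; <-cmp; <⇒≢; toℕ<n)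
open import Data.Fin.Subset using (Subset; Side; inside; outside; _∈_; _∉_; ∣_∣; ∁; _─_; ⁅_⁆; Nonempty)
open import Data.Fin.Subset.Properties
  using (_∈?_; drop-there; nonempty?; Empty-unique; ∣⊥∣≡0; p─⊥≡p; p─q⊆p; x∈p∧x≢y⇒x∈p-y; x∉p⇒x∈∁p;
         ∣∁p∣≡n∸∣p∣)
open import Data.Integer using (+_; _-_)
import Data.Integer as ℤ
open import Data.Integer.Divisibility using (_∣_)
open import Data.Vec using (_∷_; here; there)
open import Data.List using (foldr; map; allFin)
open import Data.List.Properties using (map-tabulate)
open import Data.Bool using (if_then_else_)
open import Data.Product using (Σ; ∃; ∃₂; _×_; _,_; proj₁; proj₂)
open import Data.Sum using (_⊎_; inj₁; inj₂; swap)
open import Data.Empty using (⊥-elim)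
open import Function using (_∘_; id)
open import Relation.Nullary using (does; yes; no)
open import Relation.Nullary.Decidable using (dec-true)
open import Relation.Binary using (tri<; tri≈; tri>)
open import Relation.Binary.PropositionalEquality
  using (_≡_; _≢_; refl; sym; trans; cong; cong₂; subst; module ≡-Reasoning)

open Congruence

coprime-offset : ∀ {P Q m s} → Coprime P Q → P ≡ Q + m * s → Coprime P m × Coprime Q m
coprime-offset {Q = Q} {m} {s} P⊥Q refl =
    (λ {g} (g∣P , g∣m) → P⊥Q (g∣P , ∣m+n∣m⇒∣n (subst (g ℕ.∣_) (+-comm Q (m * s)) g∣P) (∣m⇒∣m*n s g∣m)))
  , (λ (g∣Q , g∣m) → P⊥Q (∣m∣n⇒∣m+n g∣Q (∣m⇒∣m*n s g∣m) , g∣Q))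

coprime-+-* : ∀ {a b} k → Coprime a b → Coprime a (b + k * a)
coprime-+-* {a} {b} k a⊥b {g} (g∣a , g∣b+ka) =
  a⊥b (g∣a , ∣m+n∣m⇒∣n (subst (g ℕ.∣_) (+-comm b (k * a)) g∣b+ka) (∣n⇒∣m*n k g∣a))

combination-above : ∀ {m W} .{{_ : NonZero W}} → Coprime m W → ∀ e →
                    ∃₂ λ a b → a < W × m * a + b * W ≡ m * W + e
combination-above {m} {W} m⊥W e with bounded-linear-congruence W m⊥W (+ (m * W + e))
... | a , a<W , ma≡n with m≤n⇒∃[o]m+o≡n (≤-trans (*-monoʳ-≤ m (<⇒≤ a<W)) (m≤m+n (m * W) e))
...   | f , ma+f≡n with +-mod⇒∣ (m * a) f (subst (λ n → + n ≡ + (m * a) mod W) (sym ma+f≡n) (mod-sym ma≡n))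
...     | divides b f≡bW = a , b , a<W , trans (cong (_+_ (m * a)) (sym f≡bW)) ma+f≡n

pair-coefficients : ∀ {P Q m} p d → let W = Q + (suc p + d) * m in
                    P ≡ Q + m * suc d → Coprime m W → .{{_ : NonZero W}} → ∀ e → e < P * Q →
                    ∃₂ λ a b → a < W × b < P
                             × m * (a + p * b) + P * b ≡ m * W + e
                             × m * (a + (suc p + d) * b) + Q * b ≡ m * W + e
pair-coefficients {Q = Q} {m} p d refl m⊥W e e<PQ with combination-above m⊥W e
... | a , b , a<W , ma+bW≡n =
  a , b , a<W , b<P , trans (P-form Q m p d a b) ma+bW≡n , trans (Q-form Q m p d a b) ma+bW≡n
  where
  P = Q + m * suc d
  W = Q + (suc p + d) * m
  b<P : b < P
  b<P = *-cancelʳ-< W b P (begin-strict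
    b * W                       ≤⟨ m≤n+m (b * W) (m * a) ⟩
    m * a + b * W               ≡⟨ ma+bW≡n ⟩
    m * W + e                   <⟨ +-monoʳ-< (m * W) e<PQ ⟩
    m * W + P * Q               ≤⟨ m≤m+n (m * W + P * Q) _ ⟩
    m * W + P * Q + _           ≡⟨ PW-split Q m p d ⟨
    P * W                       ∎)
    where
    open ≤-Reasoning
    PW-split : ∀ Q m p d → (Q + m * suc d) * (Q + (suc p + d) * m)
                         ≡ m * (Q + (suc p + d) * m) + (Q + m * suc d) * Q
                           + (m * (p + d) * Q + m * m * d * (suc p + d))
    PW-split = solve-∀
  P-form : ∀ Q m p d a b → m * (a + p * b) + (Q + m * suc d) * b ≡ m * a + b * (Q + (suc p + d) * m)
  P-form = solve-∀
  Q-form : ∀ Q m p d a b → m * (a + (suc p + d) * b) + Q * b ≡ m * a + b * (Q + (suc p + d) * m)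
  Q-form = solve-∀

pair-representation : ∀ {P Q m p q} → p < q → Coprime P Q → 0 < Q → P ≡ Q + m * (q ∸ p) → ∀ xP xQ →
                      ∃₂ λ a b → a < Q + q * m × b < P
                               × + (a + p * b) ≡ xP mod P × + (a + q * b) ≡ xQ mod Q
pair-representation {P} {Q} {m} {p} p<q P⊥Q Q>0 P≡Q+m[q∸p] xP xQ with m≤n⇒∃[o]m+o≡n p<q
... | d , refl =
  let n₀ , n₀≡mxP , n₀≡mxQ = chinese-remainder P⊥Q (+ m ℤ.* xP) (+ m ℤ.* xQ)
      e , e<PQ , mW+e≡n₀ = residue-above (m * W) n₀ (P * Q)
      a , b , a<W , b<P , P-form , Q-form = pair-coefficients p d P≡Q+m[1+d] m⊥W e e<PQ
  in  a , b , a<W , b<P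
    , coefficient-congruence P⊥m P-form (mod-trans (mod-∣ (m∣m*n Q) mW+e≡n₀) n₀≡mxP)
    , coefficient-congruence Q⊥m Q-form (mod-trans (mod-∣ (n∣m*n P) mW+e≡n₀) n₀≡mxQ)
  where
  W = Q + (suc p + d) * m
  P≡Q+m[1+d] : P ≡ Q + m * suc d
  P≡Q+m[1+d] = trans P≡Q+m[q∸p]
                     (cong (λ t → Q + m * t) (trans (cong (_∸ p) (sym (+-suc p d))) (m+n∸m≡n p (suc d))))
  P⊥m×Q⊥m : Coprime P m × Coprime Q m
  P⊥m×Q⊥m = coprime-offset {m = m} {s = suc d} P⊥Q P≡Q+m[1+d]
  P⊥m = proj₁ P⊥m×Q⊥m
  Q⊥m = proj₂ P⊥m×Q⊥m
  m⊥W : Coprime m W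
  m⊥W = coprime-+-* (suc p + d) (Coprime.sym Q⊥m)
  instance
    P≢0 : NonZero P
    P≢0 = >-nonZero (<-≤-trans Q>0 (subst (Q ≤_) (sym P≡Q+m[1+d]) (m≤m+n Q _)))
    Q≢0 : NonZero Q
    Q≢0 = >-nonZero Q>0
    PQ≢0 : NonZero (P * Q)
    PQ≢0 = m*n≢0 P Q
    W≢0 : NonZero W
    W≢0 = >-nonZero (<-≤-trans Q>0 (m≤m+n Q _))

foldr-allFin-suc : ∀ {n} (_∙_ : ℕ → ℕ → ℕ) e (f : Fin (suc n) → ℕ) →
                   foldr _∙_ e (map f (allFin (suc n))) ≡ f zero ∙ foldr _∙_ e (map (f ∘ suc) (allFin n))
foldr-allFin-suc _∙_ e f =
  cong (λ fs → f zero ∙ foldr _∙_ e fs) (trans (map-tabulate suc f) (sym (map-tabulate id (f ∘ suc))))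

ΣFin-suc : ∀ {n} (f : Fin (suc n) → ℕ) → ΣFin (suc n) f ≡ f zero + ΣFin n (f ∘ suc)
ΣFin-suc = foldr-allFin-suc _+_ 0

⨆Fin-suc : ∀ {n} (f : Fin (suc n) → ℕ) → ⨆Fin (suc n) f ≡ f zero ⊔ ⨆Fin n (f ∘ suc)
⨆Fin-suc = foldr-allFin-suc _⊔_ 0

ΣFin-zero : ∀ n (f : Fin n → ℕ) → (∀ t → f t ≡ 0) → ΣFin n f ≡ 0
ΣFin-zero zero    f f≡0 = refl
ΣFin-zero (suc n) f f≡0 = trans (ΣFin-suc f) (cong₂ _+_ (f≡0 zero) (ΣFin-zero n (f ∘ suc) (f≡0 ∘ suc)))

δ : ∀ {n} → Fin n → Fin n → ℕ
δ t i = if does (t ≟ i) then 1 else 0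

ΣFin-δ : ∀ n (g : Fin n → ℕ) i → ΣFin n (λ t → g t * δ t i) ≡ g i
ΣFin-δ (suc n) g zero = begin
  ΣFin (suc n) (λ t → g t * δ t zero)        ≡⟨ ΣFin-suc (λ t → g t * δ t zero) ⟩
  g zero * 1 + ΣFin n (λ t → g (suc t) * 0)  ≡⟨ cong₂ _+_ (*-identityʳ (g zero)) (ΣFin-zero n _ (*-zeroʳ ∘ g ∘ suc)) ⟩
  g zero + 0                                 ≡⟨ +-identityʳ (g zero) ⟩
  g zero                                     ∎
  where open ≡-Reasoning
ΣFin-δ (suc n) g (suc i) = begin
  ΣFin (suc n) (λ t → g t * δ t (suc i))                ≡⟨ ΣFin-suc (λ t → g t * δ t (suc i)) ⟩
  g zero * 0 + ΣFin n (λ t → g (suc t) * δ t i)         ≡⟨ cong₂ _+_ (*-zeroʳ (g zero)) (ΣFin-δ n (g ∘ suc) i) ⟩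
  g (suc i)                                             ∎
  where open ≡-Reasoning

ΣFin-elemA : ∀ k (h : Fin (suc (suc k)) → ℕ) i →
             ΣFin (suc (suc k)) (λ s → h s * elemA k s i) ≡ h zero + suc (toℕ i) * h (suc zero) + h (suc (suc i))
ΣFin-elemA k h i = begin
  ΣFin (suc (suc k)) term                                             ≡⟨ ΣFin-suc term ⟩
  h zero * 1 + ΣFin (suc k) (term ∘ suc)                              ≡⟨ cong (_+_ (h zero * 1)) (ΣFin-suc (term ∘ suc)) ⟩
  h zero * 1 + (h (suc zero) * suc (toℕ i) + ΣFin k (λ t → term (suc (suc t))))
    ≡⟨ cong₂ (λ u v → u + (h (suc zero) * suc (toℕ i) + v)) (*-identityʳ (h zero)) (ΣFin-δ k (λ t → h (suc (suc t))) i) ⟩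
  h zero + (h (suc zero) * suc (toℕ i) + h (suc (suc i)))            ≡⟨ rearrange (h zero) (h (suc zero)) (suc (toℕ i)) (h (suc (suc i))) ⟩
  h zero + suc (toℕ i) * h (suc zero) + h (suc (suc i))              ∎
  where
  open ≡-Reasoning
  term : Fin (suc (suc k)) → ℕ
  term s = h s * elemA k s i
  rearrange : ∀ a b c d → a + (b * c + d) ≡ a + c * b + d
  rearrange = solve-∀

f≤⨆Fin : ∀ {n} (f : Fin n → ℕ) t → f t ≤ ⨆Fin n f
f≤⨆Fin f zero    = ≤-trans (m≤m⊔n (f zero) _) (≤-reflexive (sym (⨆Fin-suc f)))
f≤⨆Fin f (suc t) = ≤-trans (≤-trans (f≤⨆Fin (f ∘ suc) t) (m≤n⊔m (f zero) _)) (≤-reflexive (sym (⨆Fin-suc f)))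

r+m≤cO : ∀ {k} (r : Fin k → ℕ) (m : Fin k → Fin k → ℕ) {i j} → toℕ i < toℕ j →
         r j + suc (toℕ j) * m i j ≤ cO k r m
r+m≤cO {k} r m {i} {j} i<j = begin
  r j + suc (toℕ j) * m i j     ≡⟨ cong (λ b → if b then r j + suc (toℕ j) * m i j else 0) (dec-true (i <? j) i<j) ⟨
  summand i j                   ≤⟨ f≤⨆Fin (summand i) j ⟩
  ⨆Fin k (summand i)            ≤⟨ f≤⨆Fin (λ i → ⨆Fin k (summand i)) i ⟩
  cO k r m                      ∎
  where
  open ≤-Reasoning
  summand : Fin k → Fin k → ℕ
  summand i j = if does (i <? j) then r j + suc (toℕ j) * m i j else 0

∣p∣≡1+∣p─x∣ : ∀ {n} {p : Subset n} {x} → x ∈ p → ∣ p ∣ ≡ suc ∣ p ─ ⁅ x ⁆ ∣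
∣p∣≡1+∣p─x∣ {p = inside ∷ p}  here        = cong (suc ∘ ∣_∣) (sym (p─⊥≡p p))
∣p∣≡1+∣p─x∣ {p = inside ∷ p}  (there x∈p) = cong suc (∣p∣≡1+∣p─x∣ x∈p)
∣p∣≡1+∣p─x∣ {p = outside ∷ p} (there x∈p) = ∣p∣≡1+∣p─x∣ x∈p

∣p∣≡1+s⇒∣p─x∣≡s : ∀ {n} {p : Subset n} {x s} → x ∈ p → ∣ p ∣ ≡ suc s → ∣ p ─ ⁅ x ⁆ ∣ ≡ s
∣p∣≡1+s⇒∣p─x∣≡s x∈p ∣p∣≡1+s = suc-injective (trans (sym (∣p∣≡1+∣p─x∣ x∈p)) ∣p∣≡1+s)

∣p∣≡0⇒x∉p : ∀ {n} {p : Subset n} {x} → ∣ p ∣ ≡ 0 → x ∉ p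
∣p∣≡0⇒x∉p ∣p∣≡0 x∈p with trans (sym ∣p∣≡0) (∣p∣≡1+∣p─x∣ x∈p)
... | ()

∣p∣≡1+s⇒Nonempty : ∀ {n} {p : Subset n} {s} → ∣ p ∣ ≡ suc s → Nonempty p
∣p∣≡1+s⇒Nonempty {n} {p} ∣p∣≡1+s with nonempty? p
... | yes p≢∅ = p≢∅
... | no  p≡∅ with trans (sym ∣p∣≡1+s) (trans (cong ∣_∣ (Empty-unique p≡∅)) (∣⊥∣≡0 n))
...   | ()

x∉p─x : ∀ {n} {p : Subset n} x → x ∉ p ─ ⁅ x ⁆
x∉p─x {p = _ ∷ p} zero    ()
x∉p─x {p = _ ∷ p} (suc x) (there x∈p─x) = x∉p─x x x∈p─x

∣p∣≡1⇒singleton : ∀ {n} {p : Subset n} → ∣ p ∣ ≡ 1 → ∃ λ i → i ∈ p × (∀ {t} → t ∈ p → t ≡ i)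
∣p∣≡1⇒singleton {p = p} ∣p∣≡1 with ∣p∣≡1+s⇒Nonempty ∣p∣≡1
... | i , i∈p = i , i∈p , unique
  where
  unique : ∀ {t} → t ∈ p → t ≡ i
  unique {t} t∈p with t ≟ i
  ... | yes t≡i = t≡i
  ... | no  t≢i = ⊥-elim (∣p∣≡0⇒x∉p (∣p∣≡1+s⇒∣p─x∣≡s i∈p ∣p∣≡1) (x∈p∧x≢y⇒x∈p-y t∈p t≢i))

∣p∣≡2⇒pair : ∀ {n} {p : Subset n} → ∣ p ∣ ≡ 2 →
             ∃₂ λ i j → i ≢ j × i ∈ p × j ∈ p × (∀ {t} → t ∈ p → t ≡ i ⊎ t ≡ j)
∣p∣≡2⇒pair {p = p} ∣p∣≡2 with ∣p∣≡1+s⇒Nonempty ∣p∣≡2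
... | i , i∈p with ∣p∣≡1⇒singleton (∣p∣≡1+s⇒∣p─x∣≡s i∈p ∣p∣≡2)
...   | j , j∈p─i , unique = i , j , i≢j , i∈p , p─q⊆p p ⁅ i ⁆ j∈p─i , covers
  where
  i≢j : i ≢ j
  i≢j refl = x∉p─x i j∈p─i
  covers : ∀ {t} → t ∈ p → t ≡ i ⊎ t ≡ j
  covers {t} t∈p with t ≟ i
  ... | yes t≡i = inj₁ t≡i
  ... | no  t≢i = inj₂ (unique (x∈p∧x≢y⇒x∈p-y t∈p t≢i))

∣∁p∣≡s : ∀ {n} (p : Subset n) {s} → s + ∣ p ∣ ≡ n → ∣ ∁ p ∣ ≡ s
∣∁p∣≡s p {s} s+∣p∣≡n = trans (∣∁p∣≡n∸∣p∣ p) (trans (cong (_∸ ∣ p ∣) (sym s+∣p∣≡n)) (m+n∸n≡m s ∣ p ∣))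

Admissible : Side → ℕ → ℕ → Set
Admissible inside  c h = h < c
Admissible outside c h = h ≡ 0

admissible-∈ : ∀ {n side c h} {p : Subset n} → Admissible side c h → zero ∈ side ∷ p → h < c
admissible-∈ h<c here = h<c

admissible-∉ : ∀ {n side c h} {p : Subset n} → Admissible side c h → zero ∉ side ∷ p → h ≡ 0
admissible-∉ {side = inside}  _   zero∉p = ⊥-elim (zero∉p here)
admissible-∉ {side = outside} h≡0 _      = h≡0

module _ {k : ℕ}
  (r : Fin (2 + k) → ℕ) (m : Fin (2 + k) → Fin (2 + k) → ℕ)
  (r>1 : ∀ i → 1 < r i)
  (r-decreasing : ∀ i j → toℕ i < toℕ j → r j < r i)
  (r-coprime : ∀ i j → i ≢ j → Coprime (r i) (r j))
  (r-coprime-index : ∀ i → Coprime (r i) (suc (toℕ i)))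
  (r-gap : ∀ i j → toℕ i < toℕ j → 0 < m i j × r i ≡ r j + m i j * (toℕ j ∸ toℕ i))
  (x : (i : Fin (2 + k)) → Fin (r i))
  where

  private
    K = 2 + k
    instance
      r≢0 : ∀ {i} → NonZero (r i)
      r≢0 {i} = >-nonZero (<-trans z<s (r>1 i))

  Representation : Subset (2 + K) → Set
  Representation S = Σ (Fin (2 + K) → ℕ) λ h →
      (∀ s → s ∈ S → h s < cA K r m (r zero) s)
    × (∀ s → s ∉ S → h s ≡ 0)
    × (∀ i → + r i ∣ + ΣFin (2 + K) (λ s → h s * elemA K s i) - + toℕ (x i))

  r≤r₀ : ∀ i → r i ≤ r zero
  r≤r₀ zero    = ≤-refl
  r≤r₀ (suc i) = <⇒≤ (r-decreasing zero (suc i) z<s)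

  r<cO : ∀ i → r i < cO K r m
  r<cO zero = begin-strict
    r zero                  ≡⟨ proj₂ (r-gap zero one z<s) ⟩
    r one + m zero one * 1  <⟨ +-monoʳ-< (r one) m₀₁<2m₀₁ ⟩
    r one + 2 * m zero one  ≤⟨ r+m≤cO r m z<s ⟩
    cO K r m                ∎
    where
    open ≤-Reasoning
    one = suc zero
    m₀₁<2m₀₁ : m zero one * 1 < 2 * m zero one
    m₀₁<2m₀₁ = subst (_< 2 * m zero one) (sym (*-identityʳ (m zero one)))
                 (m<m+n (m zero one) (<-≤-trans (proj₁ (r-gap zero one z<s)) (m≤m+n (m zero one) 0)))
  r<cO (suc i) = <-≤-trans (m<m+n (r (suc i)) (<-≤-trans (proj₁ (r-gap zero (suc i) z<s)) (m≤m+n _ _)))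
                           (r+m≤cO r m z<s)

  complete-representation : ∀ so su (E : Subset K) ho hu → Admissible so (cO K r m) ho → Admissible su (r zero) hu →
                            (∀ t → t ∉ E → + (ho + suc (toℕ t) * hu) ≡ + toℕ (x t) mod r t) →
                            Representation (so ∷ su ∷ E)
  complete-representation so su E ho hu ho-admissible hu-admissible congruent = h , bounded , vanishing , represents
    where
    correction : ∀ t → ∃ λ c → c < r t × + (ho + suc (toℕ t) * hu + c) ≡ + toℕ (x t) mod r t
    correction t = residue-above (ho + suc (toℕ t) * hu) (+ toℕ (x t)) (r t)
    hₑ : Fin K → ℕ
    hₑ t with t ∈? E
    ... | yes _ = proj₁ (correction t)
    ... | no  _ = 0
    h : Fin (2 + K) → ℕ
    h zero          = ho
    h (suc zero)    = hu
    h (suc (suc t)) = hₑ t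
    bounded : ∀ s → s ∈ so ∷ su ∷ E → h s < cA K r m (r zero) s
    bounded zero          zero∈S = admissible-∈ ho-admissible zero∈S
    bounded (suc zero)    one∈S  = admissible-∈ hu-admissible (drop-there one∈S)
    bounded (suc (suc t)) t∈S with t ∈? E
    ... | yes _   = proj₁ (proj₂ (correction t))
    ... | no  t∉E = ⊥-elim (t∉E (drop-there (drop-there t∈S)))
    vanishing : ∀ s → s ∉ so ∷ su ∷ E → h s ≡ 0
    vanishing zero          zero∉S = admissible-∉ ho-admissible zero∉S
    vanishing (suc zero)    one∉S  = admissible-∉ hu-admissible (one∉S ∘ there)
    vanishing (suc (suc t)) t∉S with t ∈? E
    ... | yes t∈E = ⊥-elim (t∉S (there (there t∈E)))
    ... | no  _   = refl
    coordinate-congruent : ∀ t → + (ho + suc (toℕ t) * hu + hₑ t) ≡ + toℕ (x t) mod r t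
    coordinate-congruent t with t ∈? E
    ... | yes _   = proj₂ (proj₂ (correction t))
    ... | no  t∉E = subst (λ v → + v ≡ + toℕ (x t) mod r t) (sym (+-identityʳ _)) (congruent t t∉E)
    represents : ∀ i → + r i ∣ + ΣFin (2 + K) (λ s → h s * elemA K s i) - + toℕ (x i)
    represents i = subst (λ v → + r i ∣ + v - + toℕ (x i)) (sym (ΣFin-elemA K h i)) (mod⇒∣ (coordinate-congruent i))

  representation-without-o-u : (E : Subset K) → ∣ ∁ E ∣ ≡ 0 → Representation (outside ∷ outside ∷ E)
  representation-without-o-u E ∣∁E∣≡0 = complete-representation outside outside E 0 0 refl refl
    (λ t t∉E → ⊥-elim (∣p∣≡0⇒x∉p ∣∁E∣≡0 (x∉p⇒x∈∁p t∉E)))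

  representation-with-o : (E : Subset K) → ∣ ∁ E ∣ ≡ 1 → Representation (inside ∷ outside ∷ E)
  representation-with-o E ∣∁E∣≡1 with ∣p∣≡1⇒singleton ∣∁E∣≡1
  ... | i , _ , missing-only-i =
    complete-representation inside outside E (toℕ (x i)) 0 (<-trans (toℕ<n (x i)) (r<cO i)) refl congruent
    where
    congruent : ∀ t → t ∉ E → + (toℕ (x i) + suc (toℕ t) * 0) ≡ + toℕ (x t) mod r t
    congruent t t∉E with missing-only-i (x∉p⇒x∈∁p t∉E)
    ... | refl = mod-reflexive (cong +_ (trans (cong (_+_ (toℕ (x t))) (*-zeroʳ (suc (toℕ t))))
                                               (+-identityʳ (toℕ (x t)))))

  representation-with-u : (E : Subset K) → ∣ ∁ E ∣ ≡ 1 → Representation (outside ∷ inside ∷ E)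
  representation-with-u E ∣∁E∣≡1 with ∣p∣≡1⇒singleton ∣∁E∣≡1
  ... | i , _ , missing-only-i with bounded-linear-congruence (r i) (Coprime.sym (r-coprime-index i)) (+ toℕ (x i))
  ...   | hu , hu<rᵢ , [1+i]hu≡xᵢ =
    complete-representation outside inside E 0 hu refl (<-≤-trans hu<rᵢ (r≤r₀ i)) congruent
    where
    congruent : ∀ t → t ∉ E → + (suc (toℕ t) * hu) ≡ + toℕ (x t) mod r t
    congruent t t∉E with missing-only-i (x∉p⇒x∈∁p t∉E)
    ... | refl = [1+i]hu≡xᵢ

  representation-with-o-u : (E : Subset K) (i j : Fin K) → toℕ i < toℕ j →
                            (∀ {t} → t ∈ ∁ E → t ≡ i ⊎ t ≡ j) → Representation (inside ∷ inside ∷ E)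
  representation-with-o-u E i j i<j missing-only-i-j
    with pair-representation (s≤s i<j) (r-coprime i j (<⇒≢ i<j)) (<-trans z<s (r>1 j)) (proj₂ (r-gap i j i<j))
                             (+ toℕ (x i)) (+ toℕ (x j))
  ... | a , b , a<W , b<rᵢ , a+[1+i]b≡xᵢ , a+[1+j]b≡xⱼ =
    complete-representation inside inside E a b (<-≤-trans a<W (r+m≤cO r m i<j)) (<-≤-trans b<rᵢ (r≤r₀ i)) congruent
    where
    congruent : ∀ t → t ∉ E → + (a + suc (toℕ t) * b) ≡ + toℕ (x t) mod r t
    congruent t t∉E with missing-only-i-j (x∉p⇒x∈∁p t∉E)
    ... | inj₁ refl = a+[1+i]b≡xᵢ
    ... | inj₂ refl = a+[1+j]b≡xⱼ

  representation : (S : Subset (2 + K)) → ∣ S ∣ ≡ K → Representation S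
  representation (outside ∷ outside ∷ E) ∣S∣≡K = representation-without-o-u E (∣∁p∣≡s E ∣S∣≡K)
  representation (inside  ∷ outside ∷ E) ∣S∣≡K = representation-with-o E (∣∁p∣≡s E ∣S∣≡K)
  representation (outside ∷ inside  ∷ E) ∣S∣≡K = representation-with-u E (∣∁p∣≡s E ∣S∣≡K)
  representation (inside  ∷ inside  ∷ E) ∣S∣≡K with ∣p∣≡2⇒pair (∣∁p∣≡s E ∣S∣≡K)
  ... | i , j , i≢j , _ , _ , missing-only-i-j with <-cmp i j
  ...   | tri< i<j _ _ = representation-with-o-u E i j i<j missing-only-i-j
  ...   | tri≈ _ i≡j _ = ⊥-elim (i≢j i≡j)
  ...   | tri> _ _ j<i = representation-with-o-u E j i j<i (swap ∘ missing-only-i-j)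

lemma6 : (k : ℕ) → (k>1 : 1 < k)
    → (r : Fin k → ℕ) → (m : Fin k → Fin k → ℕ)
    → (∀ i → 1 < r i)
    → (∀ (i j : Fin k) → toℕ i < toℕ j → r j < r i)
    → (∀ (i j : Fin k) → i ≢ j → Coprime (r i) (r j))
    → (∀ (i : Fin k) → Coprime (r i) (suc (toℕ i)))
    → (∀ (i j : Fin k) → toℕ i < toℕ j →
         (0 < m i j)
         × (r i ≡ r j + m i j * (toℕ j ∸ toℕ i))
         × (r j ≥ m i j * toℕ i * suc (toℕ j)))
    → (x : (i : Fin k) → Fin (r i))
    → (S : Subset (suc (suc k))) → ∣ S ∣ ≡ k
    → Σ (Fin (suc (suc k)) → ℕ) λ h →
         (∀ s → s ∈ S → h s < cA k r m (r (fromℕ< (<-trans (s≤s z≤n) k>1))) s)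
         × (∀ s → s ∉ S → h s ≡ 0)
         × (∀ (i : Fin k) →
              (+ r i) ∣ (+ ΣFin (suc (suc k)) (λ s → h s * elemA k s i) - + toℕ (x i)))
lemma6 (suc (suc k)) (s≤s (s≤s z≤n)) r m r>1 r-decreasing r-coprime r-coprime-index m-spec =
  representation r m r>1 r-decreasing r-coprime r-coprime-index r-gap
  where
  r-gap : ∀ i j → toℕ i < toℕ j → 0 < m i j × r i ≡ r j + m i j * (toℕ j ∸ toℕ i)
  r-gap i j i<j = proj₁ (m-spec i j i<j) , proj₁ (proj₂ (m-spec i j i<j))
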